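{- For all integers $t\ge 1$, $i\ge 1$ and $n\ge 5$, we have $dW(t,n,i)\le t\, g_i(n)$.
   Context: For a graph $G$ whose vertices $v$ are assigned multiplicities $\omega(v)$, its (weighted) Wiener index is $W(G)=\sum_{\{u,v\}\subset V(G)}\omega(u)\omega(v)d(u,v)$, summed over unordered pairs of distinct vertices. $dW(t,n,i)$ denotes the maximum weighted Wiener index of a rooted tree of height at most $i$ (i.e. every vertex is at distance at most $i$ from the root) having $t$ non-root vertices, each of multiplicity $1$, and a root of multiplicity $n-t$. The functions $g_k$ are defined by $g_1(n)=n-1$ and $g_k(n)=n+g_{k-1}(n)-2\sqrt{g_{k-1}(n)}$ for $k>1$. -}

module Defs where

open import Data.Nat as ℕ using (ℕ; zero; suc)
open import Data.Integer as ℤ using (ℤ; +_)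
open import Data.Rational as ℚ using (ℚ)
open import Data.List using (List; []; _∷_; map; _++_; length)
open import Data.List.Relation.Unary.All using (All)
open import Data.Product using (Σ; _×_; ∃)
open import Data.Empty using (⊥)
open import Relation.Nullary using (yes; no)
open import Relation.Binary.PropositionalEquality using (_≡_)

-- Rooted (ordered) trees, as rose trees.  The shape ordering of children
-- is irrelevant for the Wiener index; every unordered rooted tree arises.

data Tree : Set where
  node : List Tree → Tree

-- A vertex is identified with its address: the list of child indices
-- along the path from the root (the root is []).
Address : Set
Address = List ℕ

mutual
  vertices : Tree → List Address
  vertices (node ts) = [] ∷ verticesF 0 ts

  verticesF : ℕ → List Tree → List Address
  verticesF i []       = []
  verticesF i (t ∷ ts) = map (i ∷_) (vertices t) ++ verticesF (suc i) ts

nonRoot : Tree → ℕ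
nonRoot T = length (vertices T) ℕ.∸ 1

HeightAtMost : ℕ → Tree → Set
HeightAtMost h T = All (λ a → length a ℕ.≤ h) (vertices T)

-- length of the longest common prefix of two addresses (depth of the LCA)
lcp : Address → Address → ℕ
lcp (x ∷ xs) (y ∷ ys) with x ℕ.≟ y
... | yes _ = suc (lcp xs ys)
... | no  _ = 0
lcp _ _ = 0

dist : Address → Address → ℕ
dist u v = (length u ℕ.+ length v) ℕ.∸ (2 ℕ.* lcp u v)

mult : ℕ → ℕ → Address → ℤ
mult n t []      = + n ℤ.- + t
mult n t (_ ∷ _) = + 1

pairSum : (Address → Address → ℤ) → List Address → ℤ
pairSum f []       = + 0
pairSum f (v ∷ vs) = sumWith vs ℤ.+ pairSum f vs
  where
  sumWith : List Address → ℤ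
  sumWith []       = + 0
  sumWith (w ∷ ws) = f v w ℤ.+ sumWith ws

wiener : ℕ → ℕ → Tree → ℤ
wiener n t T = pairSum (λ u v → mult n t u ℤ.* mult n t v ℤ.* + dist u v) (vertices T)

Admissible : ℕ → ℕ → Tree → Set
Admissible t i T = nonRoot T ≡ t × HeightAtMost i T

IsDW : ℕ → ℕ → ℕ → ℤ → Set
IsDW t n i w =
  (Σ Tree λ T → Admissible t i T × wiener n t T ≡ w) ×
  (∀ T → Admissible t i T → wiener n t T ℤ.≤ w)

-- g_k(n) as a real number, given by its lower Dedekind cut:
-- gLow k n q  means  q < g_k(n).
-- g_1(n) = n - 1;  g_k(n) = n + g_{k-1}(n) - 2 √g_{k-1}(n) = n + s² - 2s with
-- s = √g_{k-1}(n).  Since x ↦ x - 2√x is continuous and increasing on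
-- [1,∞), q < g_k(n) iff there is a rational s ≥ 1 with s² < g_{k-1}(n)
-- and q < n + s² - 2s.  (k = 0 is unused.)

ℕtoℚ : ℕ → ℚ
ℕtoℚ m = + m ℚ./ 1

gLow : ℕ → ℕ → ℚ → Set
gLow zero          n q = ⊥
gLow (suc zero)    n q = q ℚ.< ℕtoℚ n ℚ.- ℚ.1ℚ
gLow (suc (suc k)) n q =
  Σ ℚ λ s → (ℚ.1ℚ ℚ.≤ s) × gLow (suc k) n (s ℚ.* s) ×
            (q ℚ.< ℕtoℚ n ℚ.+ s ℚ.* s ℚ.- ℕtoℚ 2 ℚ.* s)

-- x ≤ t · g_k(n)  (for t ≥ 1): every rational q with q·t < x satisfies q < g_k(n)
LeTimesG : ℤ → ℕ → ℕ → ℕ → Set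
LeTimesG x t k n = ∀ (q : ℚ) → q ℚ.* ℕtoℚ t ℚ.< (x ℚ./ 1) → gLow k n q

{-# OPTIONS --safe #-}
-- Removing the edge above a non-root vertex v separates the s_v vertices of the subtree at v
-- from the remaining weight n − s_v, so W(T) = Σ_v s_v (n − s_v).  Grouping the vertices by
-- the child of the root above them, it suffices to show s (n − s) + E ≤ s · g_{k+1}(n) for a
-- child subtree with s vertices, where E ≤ (s − 1) · g_k(n) by induction on the height.  With
-- G = g_k(n) this is s + G/s ≥ 2√G, i.e. AM-GM.  Since g_k(n) is only known through its lower
-- cut, √G is approached from below by rationals on a fine grid.
module Submission where

open import Defs

module EdgeDecomposition where

  open import Data.Nat as ℕ using (ℕ; suc; _≤_)
  import Data.Nat.Properties as ℕ
  open import Data.Integer as ℤ using (ℤ; +_; _+_; _*_; _-_)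
  import Data.Integer.Properties as ℤ
  open import Data.Integer.Solver using (module +-*-Solver)
  open import Data.List using (List; []; _∷_; map; _++_; length)
  import Data.List.Properties as List
  open import Data.List.Relation.Unary.All as All using (All; []; _∷_)
  import Data.List.Relation.Unary.All.Properties as All
  open import Data.Empty using (⊥)
  open import Relation.Nullary using (yes; no; contradiction)
  open import Relation.Binary.PropositionalEquality

  open +-*-Solver using (solve; _:+_; _:*_; _:-_; _:=_; con)

  rowSum : (Address → Address → ℤ) → Address → List Address → ℤ
  rowSum f v []       = + 0
  rowSum f v (w ∷ ws) = f v w + rowSum f v ws

  crossSum : (Address → Address → ℤ) → List Address → List Address → ℤ
  crossSum f []       B = + 0
  crossSum f (a ∷ A) B = rowSum f a B + crossSum f A B

  mutual
    -- The rows of `pairSum` are added by a where-bound function of `f v vs`, which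
    -- cannot be named: the underscore stands for it and is solved by unification
    -- in `pairSum-∷`, where it is applied to two distinct variables.
    sumWith≡rowSum : ∀ f v (vs ws : List Address) → _ ≡ rowSum f v ws
    sumWith≡rowSum f v vs []       = refl
    sumWith≡rowSum f v vs (w ∷ ws) = cong (_+_ (f v w)) (sumWith≡rowSum f v vs ws)

    pairSum-∷ : ∀ f v vs → pairSum f (v ∷ vs) ≡ rowSum f v vs + pairSum f vs
    pairSum-∷ f v []       = refl
    pairSum-∷ f v (w ∷ ws) with w ∷ ws
    ... | vs = cong (λ r → f v w + r + pairSum f (w ∷ ws)) (sumWith≡rowSum f v vs ws)

  rowSum-++ : ∀ f v A B → rowSum f v (A ++ B) ≡ rowSum f v A + rowSum f v B
  rowSum-++ f v []      B = sym (ℤ.+-identityˡ _)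
  rowSum-++ f v (a ∷ A) B = trans (cong (_+_ (f v a)) (rowSum-++ f v A B)) (sym (ℤ.+-assoc (f v a) _ _))

  pairSum-++ : ∀ f A B → pairSum f (A ++ B) ≡ pairSum f A + pairSum f B + crossSum f A B
  pairSum-++ f [] B = solve 1 (λ p → p := con (+ 0) :+ p :+ con (+ 0)) refl (pairSum f B)
  pairSum-++ f (a ∷ A) B = begin
    pairSum f (a ∷ A ++ B)                                         ≡⟨ pairSum-∷ f a (A ++ B) ⟩
    rowSum f a (A ++ B) + pairSum f (A ++ B)                       ≡⟨ cong₂ _+_ (rowSum-++ f a A B) (pairSum-++ f A B) ⟩
    rowSum f a A + rowSum f a B + (pairSum f A + pairSum f B + crossSum f A B)
      ≡⟨ solve 5 (λ rA rB pA pB c → rA :+ rB :+ (pA :+ pB :+ c) := rA :+ pA :+ pB :+ (rB :+ c)) refl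
           (rowSum f a A) (rowSum f a B) (pairSum f A) (pairSum f B) (crossSum f A B) ⟩
    rowSum f a A + pairSum f A + pairSum f B + crossSum f (a ∷ A) B  ≡⟨ cong (λ p → p + pairSum f B + crossSum f (a ∷ A) B) (pairSum-∷ f a A) ⟨
    pairSum f (a ∷ A) + pairSum f B + crossSum f (a ∷ A) B          ∎
    where open ≡-Reasoning

  rowSum-cong : ∀ {P : Address → Set} {f g v} → (∀ {w} → P w → f v w ≡ g v w) →
                ∀ {ws} → All P ws → rowSum f v ws ≡ rowSum g v ws
  rowSum-cong f≗g []         = refl
  rowSum-cong f≗g (pw ∷ pws) = cong₂ _+_ (f≗g pw) (rowSum-cong f≗g pws)

  pairSum-cong : ∀ {P : Address → Set} {f g} → (∀ {v w} → P v → P w → f v w ≡ g v w) →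
                 ∀ {vs} → All P vs → pairSum f vs ≡ pairSum g vs
  pairSum-cong                 f≗g          []         = refl
  pairSum-cong {f = f} {g} f≗g {v ∷ vs} (pv ∷ pvs) = begin
    pairSum f (v ∷ vs)             ≡⟨ pairSum-∷ f v vs ⟩
    rowSum f v vs + pairSum f vs   ≡⟨ cong₂ _+_ (rowSum-cong (f≗g pv) pvs) (pairSum-cong f≗g pvs) ⟩
    rowSum g v vs + pairSum g vs   ≡⟨ pairSum-∷ g v vs ⟨
    pairSum g (v ∷ vs)             ∎
    where open ≡-Reasoning

  rowSum-*ˡ : ∀ r f v ws → rowSum (λ u w → r * f u w) v ws ≡ r * rowSum f v ws
  rowSum-*ˡ r f v []       = sym (ℤ.*-zeroʳ r)
  rowSum-*ˡ r f v (w ∷ ws) = trans (cong (_+_ (r * f v w)) (rowSum-*ˡ r f v ws)) (sym (ℤ.*-distribˡ-+ r _ _))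

  distℤ : Address → Address → ℤ
  distℤ u v = + dist u v

  dist-∷ : ∀ i a b → dist (i ∷ a) (i ∷ b) ≡ dist a b
  dist-∷ i a b with i ℕ.≟ i
  ... | no i≢i = contradiction refl i≢i
  ... | yes _ rewrite ℕ.+-suc (length a) (length b) | ℕ.+-suc (lcp a b) (lcp a b ℕ.+ 0) = refl

  dist-∷-≢ : ∀ {i j} a b → i ≢ j → dist (i ∷ a) (j ∷ b) ≡ length (i ∷ a) ℕ.+ length (j ∷ b)
  dist-∷-≢ {i} {j} a b i≢j with i ℕ.≟ j
  ... | yes i≡j = contradiction i≡j i≢j
  ... | no _    = refl

  HeadAtLeast : ℕ → Address → Set
  HeadAtLeast k []      = ⊥
  HeadAtLeast k (j ∷ _) = k ≤ j

  HeadAtLeast-pred : ∀ {k} a → HeadAtLeast (suc k) a → HeadAtLeast k a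
  HeadAtLeast-pred (j ∷ _) k<j = ℕ.<⇒≤ k<j

  verticesF-HeadAtLeast : ∀ k ts → All (HeadAtLeast k) (verticesF k ts)
  verticesF-HeadAtLeast k []       = []
  verticesF-HeadAtLeast k (t ∷ ts) =
    All.++⁺ (All.map⁺ (All.universal (λ _ → ℕ.≤-refl) (vertices t)))
            (All.map (λ {a} → HeadAtLeast-pred a) (verticesF-HeadAtLeast (suc k) ts))

  depthSum : List Address → ℤ
  depthSum []       = + 0
  depthSum (a ∷ as) = + length a + depthSum as

  depthSum-++ : ∀ A B → depthSum (A ++ B) ≡ depthSum A + depthSum B
  depthSum-++ []      B = sym (ℤ.+-identityˡ _)
  depthSum-++ (a ∷ A) B = trans (cong (_+_ (+ length a)) (depthSum-++ A B)) (sym (ℤ.+-assoc (+ length a) (depthSum A) (depthSum B)))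

  depthSum-map-∷ : ∀ i A → depthSum (map (i ∷_) A) ≡ depthSum A + + length A
  depthSum-map-∷ i []      = refl
  depthSum-map-∷ i (a ∷ A) = trans (cong (_+_ (+ suc (length a))) (depthSum-map-∷ i A))
    (solve 3 (λ x s m → con (+ 1) :+ x :+ (s :+ m) := x :+ s :+ (con (+ 1) :+ m)) refl
      (+ length a) (depthSum A) (+ length A))

  rowSum-root : ∀ A → rowSum distℤ [] A ≡ depthSum A
  rowSum-root []      = refl
  rowSum-root (a ∷ A) = cong (_+_ (+ length a)) (rowSum-root A)

  rowSum-map-∷ : ∀ i a B → rowSum distℤ (i ∷ a) (map (i ∷_) B) ≡ rowSum distℤ a B
  rowSum-map-∷ i a []      = refl
  rowSum-map-∷ i a (b ∷ B) = cong₂ _+_ (cong +_ (dist-∷ i a b)) (rowSum-map-∷ i a B)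

  pairSum-map-∷ : ∀ i A → pairSum distℤ (map (i ∷_) A) ≡ pairSum distℤ A
  pairSum-map-∷ i []      = refl
  pairSum-map-∷ i (a ∷ A) = begin
    pairSum distℤ (map (i ∷_) (a ∷ A))                                     ≡⟨ pairSum-∷ distℤ (i ∷ a) (map (i ∷_) A) ⟩
    rowSum distℤ (i ∷ a) (map (i ∷_) A) + pairSum distℤ (map (i ∷_) A)   ≡⟨ cong₂ _+_ (rowSum-map-∷ i a A) (pairSum-map-∷ i A) ⟩
    rowSum distℤ a A + pairSum distℤ A                                     ≡⟨ pairSum-∷ distℤ a A ⟨
    pairSum distℤ (a ∷ A)                                                  ∎
    where open ≡-Reasoning

  rowSum-apart : ∀ i a B → All (HeadAtLeast (suc i)) B →
                 rowSum distℤ (i ∷ a) B ≡ + length (i ∷ a) * + length B + depthSum B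
  rowSum-apart i a []            []         =
    solve 1 (λ α → con (+ 0) := α :* con (+ 0) :+ con (+ 0)) refl (+ length (i ∷ a))
  rowSum-apart i a ((j ∷ b) ∷ B) (i<j ∷ hB) = begin
    + dist (i ∷ a) (j ∷ b) + rowSum distℤ (i ∷ a) B     ≡⟨ cong₂ _+_ (cong +_ (dist-∷-≢ a b (ℕ.<⇒≢ i<j))) (rowSum-apart i a B hB) ⟩
    (α + + length (j ∷ b)) + (α * + length B + depthSum B)
      ≡⟨ solve 4 (λ α β m s → (α :+ β) :+ (α :* m :+ s) := α :* (con (+ 1) :+ m) :+ (β :+ s)) refl
           α (+ length (j ∷ b)) (+ length B) (depthSum B) ⟩
    α * + length ((j ∷ b) ∷ B) + depthSum ((j ∷ b) ∷ B)   ∎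
    where
    open ≡-Reasoning
    α = + length (i ∷ a)

  crossSum-apart : ∀ i A B → All (HeadAtLeast (suc i)) B →
    crossSum distℤ (map (i ∷_) A) B ≡ depthSum (map (i ∷_) A) * + length B + + length A * depthSum B
  crossSum-apart i []      B hB = solve 2 (λ m s → con (+ 0) := con (+ 0) :* m :+ con (+ 0) :* s) refl (+ length B) (depthSum B)
  crossSum-apart i (a ∷ A) B hB = begin
    rowSum distℤ (i ∷ a) B + crossSum distℤ (map (i ∷_) A) B
      ≡⟨ cong₂ _+_ (rowSum-apart i a B hB) (crossSum-apart i A B hB) ⟩
    (α * m + s) + (depthSum (map (i ∷_) A) * m + + length A * s)
      ≡⟨ solve 5 (λ α m s σ l → (α :* m :+ s) :+ (σ :* m :+ l :* s) := (α :+ σ) :* m :+ (con (+ 1) :+ l) :* s) refl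
           α m s (depthSum (map (i ∷_) A)) (+ length A) ⟩
    depthSum (map (i ∷_) (a ∷ A)) * m + + length (a ∷ A) * s   ∎
    where
    open ≡-Reasoning
    α = + length (i ∷ a)
    m = + length B
    s = depthSum B

  size : Tree → ℕ
  size T = length (vertices T)

  length-verticesF-∷ : ∀ i t ts → length (verticesF i (t ∷ ts)) ≡ size t ℕ.+ length (verticesF (suc i) ts)
  length-verticesF-∷ i t ts =
    trans (List.length-++ (map (i ∷_) (vertices t))) (cong (ℕ._+ length (verticesF (suc i) ts)) (List.length-map (i ∷_) (vertices t)))

  mutual
    edgeSum : ℕ → Tree → ℤ
    edgeSum n (node ts) = edgeSumF n ts

    edgeSumF : ℕ → List Tree → ℤ
    edgeSumF n []       = + 0
    edgeSumF n (t ∷ ts) = + size t * (+ n - + size t) + edgeSum n t + edgeSumF n ts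

  -- The Wiener index of the addresses A, each of weight 1, and of an extra vertex of weight
  -- n − |A| at the root.
  wienerWithRoot : ℕ → List Address → ℤ
  wienerWithRoot n A = (+ n - + length A) * depthSum A + pairSum distℤ A

  wienerWithRoot-root : ∀ n ts → wienerWithRoot n (vertices (node ts)) ≡ wienerWithRoot n (verticesF 0 ts)
  wienerWithRoot-root n ts = begin
    (+ n - + length ([] ∷ F)) * (+ 0 + depthSum F) + pairSum distℤ ([] ∷ F)
      ≡⟨ cong (_+_ ((+ n - + length ([] ∷ F)) * (+ 0 + depthSum F))) (pairSum-∷ distℤ [] F) ⟩
    (+ n - + length ([] ∷ F)) * (+ 0 + depthSum F) + (rowSum distℤ [] F + pairSum distℤ F)
      ≡⟨ cong (λ r → (+ n - + length ([] ∷ F)) * (+ 0 + depthSum F) + (r + pairSum distℤ F)) (rowSum-root F) ⟩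
    (+ n - + length ([] ∷ F)) * (+ 0 + depthSum F) + (depthSum F + pairSum distℤ F)
      ≡⟨ solve 4 (λ n l s p → (n :- (con (+ 1) :+ l)) :* (con (+ 0) :+ s) :+ (s :+ p) := (n :- l) :* s :+ p) refl
           (+ n) (+ length F) (depthSum F) (pairSum distℤ F) ⟩
    wienerWithRoot n F ∎
    where
    open ≡-Reasoning
    F = verticesF 0 ts

  wienerWithRoot-++ : ∀ n i V B → All (HeadAtLeast (suc i)) B →
    wienerWithRoot n (map (i ∷_) V ++ B) ≡ + length V * (+ n - + length V) + wienerWithRoot n V + wienerWithRoot n B
  wienerWithRoot-++ n i V B hB = begin
    (+ n - + length (A ++ B)) * depthSum (A ++ B) + pairSum distℤ (A ++ B)
      ≡⟨ cong₂ (λ l s → (+ n - + l) * s + pairSum distℤ (A ++ B)) length-A++B depthSum-A++B ⟩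
    (+ n - (v + b)) * (sV + v + sB) + pairSum distℤ (A ++ B)
      ≡⟨ cong (_+_ ((+ n - (v + b)) * (sV + v + sB))) pairSum-A++B ⟩
    (+ n - (v + b)) * (sV + v + sB) + (pV + pB + ((sV + v) * b + v * sB))
      ≡⟨ solve 7 (λ n v b sV sB pV pB →
           (n :- (v :+ b)) :* (sV :+ v :+ sB) :+ (pV :+ pB :+ ((sV :+ v) :* b :+ v :* sB))
             := v :* (n :- v) :+ ((n :- v) :* sV :+ pV) :+ ((n :- b) :* sB :+ pB))
           refl (+ n) v b sV sB pV pB ⟩
    v * (+ n - v) + wienerWithRoot n V + wienerWithRoot n B ∎
    where
    open ≡-Reasoning
    A = map (i ∷_) V
    v = + length V
    b = + length B
    sV = depthSum V
    sB = depthSum B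
    pV = pairSum distℤ V
    pB = pairSum distℤ B
    length-A++B : length (A ++ B) ≡ length V ℕ.+ length B
    length-A++B = trans (List.length-++ A) (cong (ℕ._+ length B) (List.length-map (i ∷_) V))
    depthSum-A++B : depthSum (A ++ B) ≡ sV + v + sB
    depthSum-A++B = trans (depthSum-++ A B) (cong (_+ sB) (depthSum-map-∷ i V))
    pairSum-A++B : pairSum distℤ (A ++ B) ≡ pV + pB + ((sV + v) * b + v * sB)
    pairSum-A++B = begin
      pairSum distℤ (A ++ B)                                  ≡⟨ pairSum-++ distℤ A B ⟩
      pairSum distℤ A + pB + crossSum distℤ A B               ≡⟨ cong₂ (λ p c → p + pB + c) (pairSum-map-∷ i V) (crossSum-apart i V B hB) ⟩
      pV + pB + (depthSum A * b + v * sB)                     ≡⟨ cong (λ s → pV + pB + (s * b + v * sB)) (depthSum-map-∷ i V) ⟩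
      pV + pB + ((sV + v) * b + v * sB)                       ∎

  mutual
    wienerWithRoot-edgeSum : ∀ n T → wienerWithRoot n (vertices T) ≡ edgeSum n T
    wienerWithRoot-edgeSum n (node ts) = trans (wienerWithRoot-root n ts) (wienerWithRoot-edgeSumF n 0 ts)

    wienerWithRoot-edgeSumF : ∀ n i ts → wienerWithRoot n (verticesF i ts) ≡ edgeSumF n ts
    wienerWithRoot-edgeSumF n i []       = solve 1 (λ n → (n :- con (+ 0)) :* con (+ 0) :+ con (+ 0) := con (+ 0)) refl (+ n)
    wienerWithRoot-edgeSumF n i (t ∷ ts) =
      trans (wienerWithRoot-++ n i (vertices t) (verticesF (suc i) ts) (verticesF-HeadAtLeast (suc i) ts))
            (cong₂ (λ x y → + size t * (+ n - + size t) + x + y)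
                   (wienerWithRoot-edgeSum n t) (wienerWithRoot-edgeSumF n (suc i) ts))

  wiener≡edgeSum : ∀ n T → wiener n (nonRoot T) T ≡ edgeSum n T
  wiener≡edgeSum n (node ts) = begin
    pairSum W ([] ∷ F)                                     ≡⟨ pairSum-∷ W [] F ⟩
    rowSum W [] F + pairSum W F                            ≡⟨ cong₂ _+_ root-row non-root-pairs ⟩
    (+ n - + length F) * depthSum F + pairSum distℤ F      ≡⟨ wienerWithRoot-edgeSumF n 0 ts ⟩
    edgeSumF n ts                                          ∎
    where
    open ≡-Reasoning
    F = verticesF 0 ts
    W = λ u v → mult n (length F) u * mult n (length F) v * + dist u v
    r = + n - + length F
    nonRoot-F : All (HeadAtLeast 0) F
    nonRoot-F = verticesF-HeadAtLeast 0 ts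
    root-row : rowSum W [] F ≡ r * depthSum F
    root-row = begin
      rowSum W [] F                          ≡⟨ rowSum-cong (λ { {[]} () ; {a@(_ ∷ _)} _ → cong (_* distℤ [] a) (ℤ.*-identityʳ r) }) nonRoot-F ⟩
      rowSum (λ u w → r * distℤ u w) [] F    ≡⟨ rowSum-*ˡ r distℤ [] F ⟩
      r * rowSum distℤ [] F                  ≡⟨ cong (r *_) (rowSum-root F) ⟩
      r * depthSum F                         ∎
    non-root-pairs : pairSum W F ≡ pairSum distℤ F
    non-root-pairs = pairSum-cong (λ { {[]} () ; {_ ∷ _} {[]} _ () ; {a@(_ ∷ _)} {b@(_ ∷ _)} _ _ → ℤ.*-identityˡ (distℤ a b) }) nonRoot-F

module RationalBounds where

  open import Data.Nat as ℕ using (ℕ; zero; suc; s≤s; z≤n)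
  import Data.Nat.Properties as ℕ
  open import Data.Integer as ℤ using (ℤ; +_)
  import Data.Integer.Properties as ℤ
  open import Data.Rational as ℚ using (ℚ; mkℚ; 0ℚ; 1ℚ; _+_; _*_; _-_; -_; _<_; _≤_; _/_; 1/_)
  open import Data.Rational.Literals using (fromℤ)
  import Data.Rational.Properties as ℚ
  import Data.Rational.Unnormalised as ℚᵘ
  import Data.Rational.Unnormalised.Properties as ℚᵘ
  open import Data.Rational.Solver using (module +-*-Solver)
  open import Data.Product using (∃-syntax; _×_; _,_; proj₁; proj₂)
  open import Data.Sum using (_⊎_; inj₁; inj₂)
  open import Relation.Nullary using (¬_; yes; no; contradiction)
  open import Relation.Unary using (Decidable)
  open import Relation.Binary.PropositionalEquality

  open +-*-Solver using (solve; _:+_; _:*_; _:-_; :-_; _:=_; con)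

  fromℤ-/1 : ∀ z → z / 1 ≡ fromℤ z
  fromℤ-/1 z = ℚ.↥p/↧p≡p (fromℤ z)

  fromℤ-+ : ∀ x y → fromℤ (x ℤ.+ y) ≡ fromℤ x + fromℤ y
  fromℤ-+ x y = ℚ.toℚᵘ-injective (ℚᵘ.≃-trans (ℚᵘ.*≡* denominators-1) (ℚᵘ.≃-sym (ℚ.toℚᵘ-homo-+ (fromℤ x) (fromℤ y))))
    where
    denominators-1 : (x ℤ.+ y) ℤ.* + 1 ≡ (x ℤ.* + 1 ℤ.+ y ℤ.* + 1) ℤ.* + 1
    denominators-1 = begin
      (x ℤ.+ y) ℤ.* + 1                ≡⟨ ℤ.*-identityʳ (x ℤ.+ y) ⟩
      x ℤ.+ y                          ≡⟨ cong₂ ℤ._+_ (ℤ.*-identityʳ x) (ℤ.*-identityʳ y) ⟨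
      x ℤ.* + 1 ℤ.+ y ℤ.* + 1          ≡⟨ ℤ.*-identityʳ _ ⟨
      (x ℤ.* + 1 ℤ.+ y ℤ.* + 1) ℤ.* + 1 ∎
      where open ≡-Reasoning

  fromℤ-* : ∀ x y → fromℤ (x ℤ.* y) ≡ fromℤ x * fromℤ y
  fromℤ-* x y = ℚ.toℚᵘ-injective (ℚᵘ.≃-sym (ℚ.toℚᵘ-homo-* (fromℤ x) (fromℤ y)))

  fromℤ-neg : ∀ x → fromℤ (ℤ.- x) ≡ - fromℤ x
  fromℤ-neg x = ℚ.toℚᵘ-injective (ℚᵘ.≃-sym (ℚ.toℚᵘ-homo‿- (fromℤ x)))

  fromℤ-- : ∀ x y → fromℤ (x ℤ.- y) ≡ fromℤ x - fromℤ y
  fromℤ-- x y = trans (fromℤ-+ x (ℤ.- y)) (cong (_+_ (fromℤ x)) (fromℤ-neg y))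

  fromℤ-mono-≤ : ∀ {x y} → x ℤ.≤ y → fromℤ x ≤ fromℤ y
  fromℤ-mono-≤ {x} {y} x≤y = ℚ.*≤* (subst₂ ℤ._≤_ (sym (ℤ.*-identityʳ x)) (sym (ℤ.*-identityʳ y)) x≤y)

  fromℤ-pos : ∀ k → 0ℚ < fromℤ (+ suc k)
  fromℤ-pos k = ℚ.positive⁻¹ (fromℤ (+ suc k))

  fromℤ-nonNeg : ∀ k → 0ℚ ≤ fromℤ (+ k)
  fromℤ-nonNeg k = ℚ.nonNegative⁻¹ (fromℤ (+ k))

  p≤q⇒0≤q-p : ∀ {p q} → p ≤ q → 0ℚ ≤ q - p
  p≤q⇒0≤q-p {p} {q} p≤q = subst (_≤ q - p) (ℚ.+-inverseʳ p) (ℚ.+-monoˡ-≤ (- p) p≤q)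

  0≤q-p⇒p≤q : ∀ {p q} → 0ℚ ≤ q - p → p ≤ q
  0≤q-p⇒p≤q {p} {q} 0≤q-p =
    subst₂ _≤_ (ℚ.+-identityˡ p) (solve 2 (λ p q → (q :- p) :+ p := q) refl p q) (ℚ.+-monoˡ-≤ p 0≤q-p)

  p<q⇒0<q-p : ∀ {p q} → p < q → 0ℚ < q - p
  p<q⇒0<q-p {p} {q} p<q = subst (_< q - p) (ℚ.+-inverseʳ p) (ℚ.+-monoˡ-< (- p) p<q)

  0<q-p⇒p<q : ∀ {p q} → 0ℚ < q - p → p < q
  0<q-p⇒p<q {p} {q} 0<q-p =
    subst₂ _<_ (ℚ.+-identityˡ p) (solve 2 (λ p q → (q :- p) :+ p := q) refl p q) (ℚ.+-monoˡ-< p 0<q-p)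

  +-nonNeg : ∀ {p q} → 0ℚ ≤ p → 0ℚ ≤ q → 0ℚ ≤ p + q
  +-nonNeg = ℚ.+-mono-≤

  +-pos : ∀ {p q} → 0ℚ < p → 0ℚ ≤ q → 0ℚ < p + q
  +-pos = ℚ.+-mono-<-≤

  *-nonNeg : ∀ {p q} → 0ℚ ≤ p → 0ℚ ≤ q → 0ℚ ≤ p * q
  *-nonNeg {p} {q} 0≤p 0≤q =
    ℚ.nonNegative⁻¹ _ {{ℚ.nonNeg*nonNeg⇒nonNeg p {{ℚ.nonNegative 0≤p}} q {{ℚ.nonNegative 0≤q}}}}

  square-nonNeg : ∀ p → 0ℚ ≤ p * p
  square-nonNeg p with ℚ.≤-total 0ℚ p
  ... | inj₁ 0≤p = *-nonNeg 0≤p 0≤p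
  ... | inj₂ p≤0 = subst (0ℚ ≤_) (solve 1 (λ p → (:- p) :* (:- p) := p :* p) refl p) (*-nonNeg 0≤-p 0≤-p)
    where
    0≤-p : 0ℚ ≤ - p
    0≤-p = ℚ.neg-antimono-≤ p≤0

  *-monoˡ-<-pos : ∀ {r p q} → 0ℚ < r → p < q → r * p < r * q
  *-monoˡ-<-pos {r} 0<r = ℚ.*-monoʳ-<-pos r {{ℚ.positive 0<r}}

  +-<-split : ∀ {a b c d} → a + b < c + d → a < c ⊎ b < d
  +-<-split {a} {b} {c} {d} a+b<c+d with a ℚ.<? c | b ℚ.<? d
  ... | yes a<c | _       = inj₁ a<c
  ... | no  _   | yes b<d = inj₂ b<d
  ... | no a≮c  | no b≮d  = contradiction (ℚ.<-≤-trans a+b<c+d (ℚ.+-mono-≤ (ℚ.≮⇒≥ a≮c) (ℚ.≮⇒≥ b≮d))) (ℚ.<-irrefl refl)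

  *-monoˡ-≤-nonNeg : ∀ {r p q} → 0ℚ ≤ r → p ≤ q → r * p ≤ r * q
  *-monoˡ-≤-nonNeg {r} 0≤r = ℚ.*-monoˡ-≤-nonNeg r {{ℚ.nonNegative 0≤r}}

  *-cancelˡ-<-pos : ∀ {r p q} → 0ℚ < r → r * p < r * q → p < q
  *-cancelˡ-<-pos {r} 0<r = ℚ.*-cancelˡ-<-nonNeg r {{ℚ.nonNegative (ℚ.<⇒≤ 0<r)}}

  1≤p⇒p≤p*p : ∀ {p} → 1ℚ ≤ p → p ≤ p * p
  1≤p⇒p≤p*p {p} 1≤p = subst (_≤ p * p) (ℚ.*-identityʳ p) (*-monoˡ-≤-nonNeg (ℚ.≤-trans (ℚ.nonNegative⁻¹ 1ℚ) 1≤p) 1≤p)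

  pos-invertible : ∀ {q} → 0ℚ < q → ∃[ r ] 0ℚ < r × q * r ≡ 1ℚ
  pos-invertible {q} 0<q =
    (1/ q) {{ℚ.>-nonZero 0<q}} ,
    ℚ.positive⁻¹ _ {{ℚ.1/pos⇒pos q {{ℚ.positive 0<q}}}} ,
    ℚ.*-inverseʳ q {{ℚ.>-nonZero 0<q}}

  exact-quotient : ∀ x {q} → 0ℚ < q → ∃[ y ] q * y ≡ x
  exact-quotient x {q} 0<q =
    let r , _ , qr≡1 = pos-invertible 0<q
    in x * r , trans (solve 3 (λ q x r → q :* (x :* r) := x :* (q :* r)) refl q x r)
                     (trans (cong (x *_) qr≡1) (ℚ.*-identityʳ x))

  archimedean : ∀ p → ∃[ k ] p < fromℤ (+ suc k)
  archimedean (mkℚ a d _) = ℤ.∣ a ∣ , ℚ.*<* (begin-strict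
    a ℤ.* + 1                      ≡⟨ ℤ.*-identityʳ a ⟩
    a                              ≤⟨ i≤+∣i∣ a ⟩
    + ℤ.∣ a ∣                      <⟨ ℤ.+<+ (ℕ.s≤s (ℕ.m≤m*n ℤ.∣ a ∣ (suc d))) ⟩
    + suc (ℤ.∣ a ∣ ℕ.* suc d)      ≤⟨ ℤ.+≤+ (ℕ.s≤s (ℕ.m≤n+m _ d)) ⟩
    + suc ℤ.∣ a ∣ ℤ.* + suc d      ∎)
    where
    open ℤ.≤-Reasoning
    i≤+∣i∣ : ∀ i → i ℤ.≤ + ℤ.∣ i ∣
    i≤+∣i∣ (+ _)     = ℤ.≤-refl
    i≤+∣i∣ ℤ.-[1+ _ ] = ℤ.-≤+

  archimedean-* : ∀ p {q} → 0ℚ < q → ∃[ k ] p < fromℤ (+ suc k) * q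
  archimedean-* p {q} 0<q =
    let G , qG≡p = exact-quotient p 0<q
        k , G<K = archimedean G
    in k , subst (_< fromℤ (+ suc k) * q) (trans (ℚ.*-comm G q) qG≡p) (ℚ.*-monoˡ-<-pos q {{ℚ.positive 0<q}} G<K)

  archimedean-small : ∀ {a} b → 0ℚ < a → ∃[ ε ] 0ℚ < ε × ε ≤ 1ℚ × ε * b < a
  archimedean-small {a} b 0<a = ε , 0<ε , ε≤1 , εb<a
    where
    k = proj₁ (archimedean-* b 0<a)
    K = fromℤ (+ suc k)
    b<Ka : b < K * a
    b<Ka = proj₂ (archimedean-* b 0<a)
    inverse = pos-invertible (fromℤ-pos k)
    ε = proj₁ inverse
    0<ε : 0ℚ < ε
    0<ε = proj₁ (proj₂ inverse)
    Kε≡1 : K * ε ≡ 1ℚ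
    Kε≡1 = proj₂ (proj₂ inverse)
    ε≤1 : ε ≤ 1ℚ
    ε≤1 = begin
      ε          ≡⟨ ℚ.*-identityʳ ε ⟨
      ε * 1ℚ     ≤⟨ *-monoˡ-≤-nonNeg (ℚ.<⇒≤ 0<ε) (fromℤ-mono-≤ {+ 1} {+ suc k} (ℤ.+≤+ (s≤s z≤n))) ⟩
      ε * K      ≡⟨ trans (ℚ.*-comm ε K) Kε≡1 ⟩
      1ℚ         ∎
      where open ℚ.≤-Reasoning
    εb<a : ε * b < a
    εb<a = begin-strict
      ε * b        <⟨ *-monoˡ-<-pos 0<ε b<Ka ⟩
      ε * (K * a)  ≡⟨ solve 3 (λ ε K a → ε :* (K :* a) := (K :* ε) :* a) refl ε K a ⟩
      K * ε * a    ≡⟨ cong (_* a) Kε≡1 ⟩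
      1ℚ * a       ≡⟨ ℚ.*-identityˡ a ⟩
      a            ∎
      where open ℚ.≤-Reasoning

  crossing : ∀ {P : ℕ → Set} → Decidable P → P 0 → ∀ m → ¬ P m → ∃[ j ] P j × ¬ P (suc j)
  crossing P? P0 zero    ¬Pm = contradiction P0 ¬Pm
  crossing P? P0 (suc m) ¬Pm with P? m
  ... | yes Pm  = m , Pm , ¬Pm
  ... | no ¬Pm′ = crossing P? P0 m ¬Pm′

  sqrt-approx : ∀ {H ε} → 1ℚ < H → 0ℚ < ε → ∃[ y ] 1ℚ ≤ y × y * y < H × H ≤ (y + ε) * (y + ε)
  sqrt-approx {H} {ε} 1<H 0<ε = y j , 1≤y j , y²<H , H≤[y+ε]²
    where
    y : ℕ → ℚ
    y j = 1ℚ + fromℤ (+ j) * ε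
    1≤y : ∀ j → 1ℚ ≤ y j
    1≤y j = subst (_≤ y j) (ℚ.+-identityʳ 1ℚ) (ℚ.+-monoʳ-≤ 1ℚ (*-nonNeg (fromℤ-nonNeg j) (ℚ.<⇒≤ 0<ε)))
    y[1+j]≡y+ε : ∀ j → y (suc j) ≡ y j + ε
    y[1+j]≡y+ε j = trans (cong (λ J → 1ℚ + J * ε) (fromℤ-+ (+ 1) (+ j)))
      (solve 2 (λ J ε → con 1ℚ :+ (con 1ℚ :+ J) :* ε := (con 1ℚ :+ J :* ε) :+ ε) refl (fromℤ (+ j)) ε)
    y²<H-at-0 : y 0 * y 0 < H
    y²<H-at-0 = subst (_< H) (solve 1 (λ ε → con 1ℚ := (con 1ℚ :+ con 0ℚ :* ε) :* (con 1ℚ :+ con 0ℚ :* ε)) refl ε) 1<H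
    k = proj₁ (archimedean-* H 0<ε)
    y²≮H-at-k : ¬ (y (suc k) * y (suc k) < H)
    y²≮H-at-k = ℚ.<-asym (ℚ.<-≤-trans H<y (1≤p⇒p≤p*p (1≤y (suc k))))
      where
      H<y : H < y (suc k)
      H<y = ℚ.<-≤-trans (proj₂ (archimedean-* H 0<ε))
              (subst (_≤ y (suc k)) (ℚ.+-identityˡ Kε) (ℚ.+-monoˡ-≤ Kε (ℚ.nonNegative⁻¹ 1ℚ)))
        where Kε = fromℤ (+ suc k) * ε
    step = crossing (λ j → y j * y j ℚ.<? H) y²<H-at-0 (suc k) y²≮H-at-k
    j = proj₁ step
    y²<H : y j * y j < H
    y²<H = proj₁ (proj₂ step)
    H≤[y+ε]² : H ≤ (y j + ε) * (y j + ε)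
    H≤[y+ε]² = subst (λ z → H ≤ z * z) (y[1+j]≡y+ε j) (ℚ.≮⇒≥ (proj₂ (proj₂ step)))

  sqrt-approx-error : ∀ {H y ε} → 1ℚ ≤ y → y * y < H → H ≤ (y + ε) * (y + ε) → 0ℚ ≤ ε → ε ≤ 1ℚ →
                     H - y * y ≤ ε * (fromℤ (+ 2) * H + 1ℚ)
  sqrt-approx-error {H} {y} {ε} 1≤y y²<H H≤[y+ε]² 0≤ε ε≤1 = 0≤q-p⇒p≤q (subst (0ℚ ≤_)
    (solve 3 (λ H y ε → ((y :+ ε) :* (y :+ ε) :- H) :+ (con (fromℤ (+ 2)) :* ε :* (H :- y) :+ ε :* (con 1ℚ :- ε))
                        := ε :* (con (fromℤ (+ 2)) :* H :+ con 1ℚ) :- (H :- y :* y)) refl H y ε)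
    (+-nonNeg (p≤q⇒0≤q-p H≤[y+ε]²)
      (+-nonNeg (*-nonNeg (*-nonNeg (fromℤ-nonNeg 2) 0≤ε) (p≤q⇒0≤q-p y≤H))
                (*-nonNeg 0≤ε (p≤q⇒0≤q-p ε≤1)))))
    where
    y≤H : y ≤ H
    y≤H = ℚ.≤-trans (1≤p⇒p≤p*p 1≤y) (ℚ.<⇒≤ y²<H)

  amgm-error : ∀ {ν S H q y} → 0ℚ ≤ S → y * y < H →
    (1ℚ + S) * (H - y * y) < ((1ℚ + S) * (ν - (1ℚ + S)) + S * H) - q * (1ℚ + S) →
    q < ν + y * y - fromℤ (+ 2) * y
  amgm-error {ν} {S} {H} {q} {y} 0≤S y²<H error<gap =
    0<q-p⇒p<q (*-cancelˡ-<-pos 0<N (subst₂ _<_ (sym (ℚ.*-zeroʳ N))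
      (solve 5 (λ ν S H q y →
          ((((con 1ℚ :+ S) :* (ν :- (con 1ℚ :+ S)) :+ S :* H) :- q :* (con 1ℚ :+ S)) :- (con 1ℚ :+ S) :* (H :- y :* y))
          :+ (((con 1ℚ :+ S) :- y) :* ((con 1ℚ :+ S) :- y) :+ (H :- y :* y))
        := (con 1ℚ :+ S) :* ((ν :+ y :* y :- con (fromℤ (+ 2)) :* y) :- q)) refl ν S H q y)
      (+-pos (p<q⇒0<q-p error<gap) (+-nonNeg (square-nonNeg (N - y)) (p≤q⇒0≤q-p (ℚ.<⇒≤ y²<H))))))
    where
    N = 1ℚ + S
    0≤N : 0ℚ ≤ N
    0≤N = +-nonNeg (ℚ.nonNegative⁻¹ 1ℚ) 0≤S
    0<N : 0ℚ < N
    0<N = +-pos (ℚ.positive⁻¹ 1ℚ) 0≤S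

  -- With N = 1 + S the hypothesis reads q < ν + H − (N + H/N), and N + H/N ≥ 2√H; the
  -- witness x approximates √H from below.
  amgm : ∀ {ν S H q} → 0ℚ ≤ S → 1ℚ < H →
         q * (1ℚ + S) < (1ℚ + S) * (ν - (1ℚ + S)) + S * H →
         ∃[ x ] 1ℚ ≤ x × x * x < H × q < ν + x * x - fromℤ (+ 2) * x
  amgm {ν} {S} {H} {q} 0≤S 1<H q*N<bound =
    let ε , 0<ε , ε≤1 , εB<gap = archimedean-small (N * (fromℤ (+ 2) * H + 1ℚ)) (p<q⇒0<q-p q*N<bound)
        y , 1≤y , y²<H , H≤[y+ε]² = sqrt-approx {H} {ε} 1<H 0<ε
        error≤εB : N * (H - y * y) ≤ ε * (N * (fromℤ (+ 2) * H + 1ℚ))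
        error≤εB = subst (N * (H - y * y) ≤_) (solve 3 (λ N ε X → N :* (ε :* X) := ε :* (N :* X)) refl N ε (fromℤ (+ 2) * H + 1ℚ))
                     (*-monoˡ-≤-nonNeg 0≤N (sqrt-approx-error {H} {y} {ε} 1≤y y²<H H≤[y+ε]² (ℚ.<⇒≤ 0<ε) ε≤1))
    in y , 1≤y , y²<H , amgm-error {ν} {S} {H} {q} {y} 0≤S y²<H (ℚ.≤-<-trans error≤εB εB<gap)
    where
    N = 1ℚ + S
    0≤N : 0ℚ ≤ N
    0≤N = +-nonNeg (ℚ.nonNegative⁻¹ 1ℚ) 0≤S

module EdgeSumBound where

  open EdgeDecomposition using (edgeSum; edgeSumF; size; length-verticesF-∷)
  open RationalBounds
  open import Data.Nat as ℕ using (ℕ; zero; suc; s≤s; z≤n)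
  import Data.Nat.Properties as ℕ
  open import Data.Integer as ℤ using (ℤ; +_)
  open import Data.Rational as ℚ using (ℚ; 0ℚ; 1ℚ; _+_; _*_; _-_; _<_; _≤_)
  open import Data.Rational.Literals using (fromℤ)
  import Data.Rational.Properties as ℚ
  open import Data.Rational.Solver using (module +-*-Solver)
  open import Data.List using ([]; _∷_; map; length)
  open import Data.List.Relation.Unary.All as All using (All; []; _∷_)
  import Data.List.Relation.Unary.All.Properties as All
  open import Data.Product using (∃-syntax; _×_; _,_)
  open import Data.Sum using ([_,_]′)
  open import Relation.Nullary using (contradiction)
  open import Relation.Binary.PropositionalEquality

  open +-*-Solver using (solve; _:+_; _:*_; _:-_; _:=_; con)

  -- LeTimesG with integers embedded by fromℤ rather than by _/ 1, which normalises through
  -- a gcd and so does not compute on open terms.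
  LeTimesG′ : ℤ → ℕ → ℕ → ℕ → Set
  LeTimesG′ x t k n = ∀ q → q * fromℤ (+ t) < fromℤ x → gLow k n q

  LeTimesG′⇒LeTimesG : ∀ {x t k n} → LeTimesG′ x t k n → LeTimesG x t k n
  LeTimesG′⇒LeTimesG {x} {t} h q q*t<x = h q (subst₂ (λ t′ x′ → q * t′ < x′) (fromℤ-/1 (+ t)) (fromℤ-/1 x) q*t<x)

  LeTimesG′-0 : ∀ {k n} → LeTimesG′ (+ 0) 0 k n
  LeTimesG′-0 q q*0<0 = contradiction q*0<0 (ℚ.<-irrefl (ℚ.*-zeroʳ q))

  LeTimesG′-+ : ∀ {x y t u k n} → LeTimesG′ x t k n → LeTimesG′ y u k n → LeTimesG′ (x ℤ.+ y) (t ℕ.+ u) k n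
  LeTimesG′-+ {x} {y} {t} {u} x≤tg y≤ug q q*[t+u]<x+y =
    [ x≤tg q , y≤ug q ]′ (+-<-split (subst₂ _<_ q*[t+u]≡ (fromℤ-+ x y) q*[t+u]<x+y))
    where
    q*[t+u]≡ : q * fromℤ (+ t ℤ.+ + u) ≡ q * fromℤ (+ t) + q * fromℤ (+ u)
    q*[t+u]≡ = trans (cong (q *_) (fromℤ-+ (+ t) (+ u))) (ℚ.*-distribˡ-+ q _ _)

  module _ {n : ℕ} (3≤n : 3 ℕ.≤ n) where

    private
      ν = ℕtoℚ n

    1<n-1 : 1ℚ < ν - 1ℚ
    1<n-1 = ℚ.<-≤-trans (ℚ.*<* (ℤ.+<+ (s≤s (s≤s z≤n))))
              (subst (λ ν′ → fromℤ (+ 3) - 1ℚ ≤ ν′ - 1ℚ) (sym (fromℤ-/1 (+ n)))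
                (ℚ.+-monoˡ-≤ (ℚ.- 1ℚ) (fromℤ-mono-≤ (ℤ.+≤+ 3≤n))))

    n-1≤g : ∀ k q → q < ν - 1ℚ → gLow (suc k) n q
    n-1≤g zero    q q<n-1 = q<n-1
    n-1≤g (suc k) q q<n-1 = 1ℚ , ℚ.≤-refl , n-1≤g k (1ℚ * 1ℚ) 1<n-1 ,
      subst (q <_) (solve 1 (λ ν → ν :- con 1ℚ := ν :+ con 1ℚ :* con 1ℚ :- con (ℕtoℚ 2) :* con 1ℚ) refl ν) q<n-1

    fromℤ-edge : ∀ s e → fromℤ (+ s ℤ.* (+ n ℤ.- + s) ℤ.+ e) ≡ fromℤ (+ s) * (ν - fromℤ (+ s)) + fromℤ e
    fromℤ-edge s e = begin
      fromℤ (+ s ℤ.* (+ n ℤ.- + s) ℤ.+ e)                  ≡⟨ fromℤ-+ (+ s ℤ.* (+ n ℤ.- + s)) e ⟩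
      fromℤ (+ s ℤ.* (+ n ℤ.- + s)) + fromℤ e              ≡⟨ cong (_+ fromℤ e) (fromℤ-* (+ s) (+ n ℤ.- + s)) ⟩
      fromℤ (+ s) * fromℤ (+ n ℤ.- + s) + fromℤ e          ≡⟨ cong (λ d → fromℤ (+ s) * d + fromℤ e) (fromℤ-- (+ n) (+ s)) ⟩
      fromℤ (+ s) * (fromℤ (+ n) - fromℤ (+ s)) + fromℤ e  ≡⟨ cong (λ ν′ → fromℤ (+ s) * (ν′ - fromℤ (+ s)) + fromℤ e) (fromℤ-/1 (+ n)) ⟨
      fromℤ (+ s) * (ν - fromℤ (+ s)) + fromℤ e            ∎
      where open ≡-Reasoning

    LeTimesG′-leaf : ∀ k → LeTimesG′ (+ 1 ℤ.* (+ n ℤ.- + 1) ℤ.+ + 0) 1 (suc k) n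
    LeTimesG′-leaf k q q<n-1 = n-1≤g k q (subst₂ _<_ (ℚ.*-identityʳ q)
      (trans (fromℤ-edge 1 (+ 0)) (solve 1 (λ ν → con 1ℚ :* (ν :- con 1ℚ) :+ con 0ℚ := ν :- con 1ℚ) refl ν)) q<n-1)

    -- H is the larger of n − 1 and e/s; the first keeps H above 1.
    ratio-below-g : ∀ k e s → LeTimesG′ e (suc s) (suc k) n →
      ∃[ H ] 1ℚ < H × fromℤ e ≤ fromℤ (+ suc s) * H × (∀ q → q < H → gLow (suc k) n q)
    ratio-below-g k e s e≤sg = from-quotient (exact-quotient (fromℤ e) 0<S)
      where
      S = fromℤ (+ suc s)
      0<S : 0ℚ < S
      0<S = fromℤ-pos s
      from-quotient : ∃[ G ] S * G ≡ fromℤ e →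
                      ∃[ H ] 1ℚ < H × fromℤ e ≤ S * H × (∀ q → q < H → gLow (suc k) n q)
      from-quotient (G , SG≡e) =
        [ (λ G≤n-1 → ν - 1ℚ , 1<n-1 , subst (_≤ S * (ν - 1ℚ)) SG≡e (*-monoˡ-≤-nonNeg (ℚ.<⇒≤ 0<S) G≤n-1) , n-1≤g k)
        , (λ n-1≤G → G , ℚ.<-≤-trans 1<n-1 n-1≤G , ℚ.≤-reflexive (sym SG≡e) , G≤g)
        ]′ (ℚ.≤-total G (ν - 1ℚ))
        where
        G≤g : ∀ q → q < G → gLow (suc k) n q
        G≤g q q<G = e≤sg q (subst (q * S <_) (trans (ℚ.*-comm G S) SG≡e) (ℚ.*-monoˡ-<-pos S {{ℚ.positive 0<S}} q<G))

    LeTimesG′-edge : ∀ k s e → LeTimesG′ e (suc s) (suc k) n →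
      LeTimesG′ (+ suc (suc s) ℤ.* (+ n ℤ.- + suc (suc s)) ℤ.+ e) (suc (suc s)) (suc (suc k)) n
    LeTimesG′-edge k s e e≤sg q q*N<… = from-level (ratio-below-g k e s e≤sg)
      where
      S = fromℤ (+ suc s)
      N≡1+S : fromℤ (+ suc (suc s)) ≡ 1ℚ + S
      N≡1+S = fromℤ-+ (+ 1) (+ suc s)
      q*N<edgeTerm : q * (1ℚ + S) < (1ℚ + S) * (ν - (1ℚ + S)) + fromℤ e
      q*N<edgeTerm = subst₂ _<_ (cong (q *_) N≡1+S)
              (trans (fromℤ-edge (suc (suc s)) e) (cong (λ N → N * (ν - N) + fromℤ e) N≡1+S)) q*N<…
      from-level : ∃[ H ] 1ℚ < H × fromℤ e ≤ S * H × (∀ q → q < H → gLow (suc k) n q) → gLow (suc (suc k)) n q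
      from-level (H , 1<H , e≤SH , H≤g) =
        let x , 1≤x , x²<H , q<… = amgm {ν} {S} {H} {q} (ℚ.<⇒≤ (fromℤ-pos s)) 1<H
                                     (ℚ.<-≤-trans q*N<edgeTerm (ℚ.+-monoʳ-≤ ((1ℚ + S) * (ν - (1ℚ + S))) e≤SH))
        in x , 1≤x , H≤g (x * x) x²<H , q<…

    HeightAtMost-child : ∀ {k i} t → All (λ a → length a ℕ.≤ suc k) (map (i ∷_) (vertices t)) → HeightAtMost k t
    HeightAtMost-child t h = All.map ℕ.≤-pred (All.map⁻ h)

    mutual
      edgeSum-bound : ∀ k T → HeightAtMost (suc k) T → LeTimesG′ (edgeSum n T) (nonRoot T) (suc k) n
      edgeSum-bound k (node ts) (_ ∷ h) = edgeSumF-bound k 0 ts h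

      edgeSumF-bound : ∀ k i ts → All (λ a → length a ℕ.≤ suc k) (verticesF i ts) →
                       LeTimesG′ (edgeSumF n ts) (length (verticesF i ts)) (suc k) n
      edgeSumF-bound k i []       [] = LeTimesG′-0
      edgeSumF-bound k i (t ∷ ts) h  =
        subst (λ m → LeTimesG′ (edgeSumF n (t ∷ ts)) m (suc k) n) (sym (length-verticesF-∷ i t ts))
          (LeTimesG′-+ (subtree-bound k t (HeightAtMost-child t (All.++⁻ˡ (map (i ∷_) (vertices t)) h)))
                       (edgeSumF-bound k (suc i) ts (All.++⁻ʳ (map (i ∷_) (vertices t)) h)))

      subtree-bound : ∀ k T → HeightAtMost k T →
                      LeTimesG′ (+ size T ℤ.* (+ n ℤ.- + size T) ℤ.+ edgeSum n T) (size T) (suc k) n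
      subtree-bound k       (node [])               _            = LeTimesG′-leaf k
      subtree-bound zero    (node (node _ ∷ _))     (_ ∷ () ∷ _)
      subtree-bound (suc k) T@(node (node _ ∷ _))   h            = LeTimesG′-edge k _ _ (edgeSum-bound k T h)

open import Data.Nat using (ℕ; _≤_; suc; s≤s; z≤n)
import Data.Nat.Properties as ℕ
open import Data.Integer using (ℤ)
open import Data.Product using (_,_)
open import Relation.Binary.PropositionalEquality using (refl; sym; subst)
open EdgeDecomposition using (wiener≡edgeSum)
open EdgeSumBound using (LeTimesG′; LeTimesG′⇒LeTimesG; edgeSum-bound)

proposition4p5 : (t i n : ℕ) → 1 ≤ t → 1 ≤ i → 5 ≤ n →
    (w : ℤ) → IsDW t n i w → LeTimesG w t i n
proposition4p5 t (suc k) n _ _ 5≤n w ((T , (refl , T-height) , refl) , _) =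
  LeTimesG′⇒LeTimesG (subst (λ x → LeTimesG′ x (nonRoot T) (suc k) n) (sym (wiener≡edgeSum n T))
                             (edgeSum-bound (ℕ.≤-trans (s≤s (s≤s (s≤s z≤n))) 5≤n) k T T-height))
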